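{- Let $\varphi=(1+\sqrt5)/2$, $\gamma=1/\varphi$, and let $L$, $U$, $W$ be the lower Wythoff, upper Wythoff and Wythoff swap sequences (defined below). Then for all $n\ge 1$, $$W(U(n))=\lfloor \gamma\, U(n)\rfloor,\qquad W(L(n))=\lfloor \varphi\, L(n)\rfloor+1.$$
   Context: The lower and upper Wythoff sequences are $L(n)=\lfloor n\varphi\rfloor$ and $U(n)=\lfloor n\varphi^2\rfloor$ for $n\ge 1$; the sets $\{L(n):n\ge1\}$ and $\{U(n):n\ge1\}$ are disjoint with union the set of positive integers. The Wythoff swap sequence $W$ on the nonnegative integers is defined by $W(0)=0$ and $W(L(n))=U(n)$, $W(U(n))=L(n)$ for all $n\ge 1$. -}

module Defs where

open import Data.Nat using (ℕ; zero; suc; _+_; _*_; _∸_; _^_; _≤ᵇ_)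
open import Data.Bool using (Bool; true; false; if_then_else_; _∨_)

-- No reals in agda-stdlib.  φ = (1+√5)/2, γ = 1/φ = (√5-1)/2, φ² = (3+√5)/2.
-- For naturals m, x we decide the real inequalities exactly by integer arithmetic:

-- m ≤ x·φ   ⇔  2m - x ≤ x√5   ⇔  2m ≤ x  ∨  (2m - x)² ≤ 5x²
leMulφ : ℕ → ℕ → Bool
leMulφ m x = (2 * m ≤ᵇ x) ∨ ((2 * m ∸ x) ^ 2 ≤ᵇ 5 * (x * x))

-- m ≤ x·φ²  ⇔  2m - 3x ≤ x√5  ⇔  2m ≤ 3x  ∨  (2m - 3x)² ≤ 5x²
leMulφ² : ℕ → ℕ → Bool
leMulφ² m x = (2 * m ≤ᵇ 3 * x) ∨ ((2 * m ∸ 3 * x) ^ 2 ≤ᵇ 5 * (x * x))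

-- m ≤ x·γ   ⇔  2m + x ≤ x√5   ⇔  (2m + x)² ≤ 5x²
leMulγ : ℕ → ℕ → Bool
leMulγ m x = (2 * m + x) ^ 2 ≤ᵇ 5 * (x * x)

count : (ℕ → Bool) → ℕ → ℕ
count p zero    = zero
count p (suc k) = count p k + (if p (suc k) then 1 else 0)

-- For real y ≥ 0, ⌊y⌋ = #{ m ≥ 1 | m ≤ y }.  Since x·φ ≤ 2x, x·φ² ≤ 3x, x·γ ≤ x,
-- it suffices to count up to these bounds.
⌊_·φ⌋ : ℕ → ℕ
⌊ x ·φ⌋ = count (λ m → leMulφ m x) (2 * x)

⌊_·φ²⌋ : ℕ → ℕ
⌊ x ·φ²⌋ = count (λ m → leMulφ² m x) (3 * x)

⌊_·γ⌋ : ℕ → ℕ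
⌊ x ·γ⌋ = count (λ m → leMulγ m x) x

L : ℕ → ℕ
L n = ⌊ n ·φ⌋

U : ℕ → ℕ
U n = ⌊ n ·φ²⌋

-- Let n = k + 1 and ℓ = L n, so ℓ < nφ < ℓ + 1. Splitting the count that defines U at n gives
-- U n = n + ℓ. As γ = 1/φ, a ≤ bφ iff a ≤ (b + a)γ, whence ⌊(n + ℓ)γ⌋ = ℓ. As φ = 1 + γ,
-- b + ℓ ≤ ℓφ iff b ≤ ℓγ; and k ≤ ℓγ < n (from nφ < ℓ + 1, resp. ℓ < nφ and the irrationality
-- of φ), whence ⌊ℓφ⌋ = k + ℓ = U n − 1. All inequalities with φ and γ are squared out, and a
-- floor is recognised through the counting definition: count p B = a when p holds exactly on 1, …, a ≤ B.
module Submission where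

open import Defs
open import Data.Bool using (Bool; true; false; T; _∨_; if_then_else_)
open import Data.Bool.Properties using (T-≡; T-∨; ⇔→≡)
open import Data.List using (_∷_; [])
open import Data.Nat using (ℕ; zero; suc; _+_; _*_; _≤_; _∸_; _^_; _<_; _⊓_; _≤ᵇ_; z≤n; s≤s; _≤?_; _<?_)
open import Data.Nat.Induction using (<-rec)
open import Data.Nat.Properties
open import Data.Nat.Tactic.RingSolver using (solve)
open import Data.Product using (_×_; Σ-syntax; _,_; proj₁; proj₂)
open import Data.Sum using (inj₁)
open import Data.Unit using (tt)
open import Function using (_∘_)
open import Function.Bundles using (_⇔_; mk⇔; Equivalence)
open import Function.Properties.Equivalence using () renaming (sym to ⇔-sym; trans to ⇔-trans)
open import Relation.Binary.PropositionalEquality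
  using (_≡_; refl; sym; trans; cong; cong₂; subst; subst₂; module ≡-Reasoning)
open import Relation.Nullary using (¬_; contradiction)
open import Relation.Nullary.Decidable using (Dec; decidable-stable; T?; yes; no)

open Equivalence using (to; from)

private
  variable
    p q : ℕ → Bool
    a b c k m x B : ℕ

T-injective : ∀ {u v} → T u ⇔ T v → u ≡ v
T-injective h = ⇔→≡ (⇔-trans (⇔-sym T-≡) (⇔-trans h T-≡))

¬T⇒≡false : ∀ {u} → ¬ T u → u ≡ false
¬T⇒≡false {false} _ = refl
¬T⇒≡false {true} ¬t = contradiction tt ¬t

T-≤ᵇ : T (m ≤ᵇ x) ⇔ m ≤ x
T-≤ᵇ = mk⇔ (≤ᵇ⇒≤ _ _) ≤⇒≤ᵇ

≤-⇔-offset : ∀ c {m n r s} → m ≡ c + r → n ≡ c + s → m ≤ n ⇔ r ≤ s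
≤-⇔-offset c refl refl = mk⇔ (+-cancelˡ-≤ c _ _) (+-monoʳ-≤ c)

≤-⇔-4* : m ≤ x ⇔ 4 * m ≤ 4 * x
≤-⇔-4* = mk⇔ (*-monoʳ-≤ 4) (*-cancelˡ-≤ 4)

≤ᵇ-+-cancelˡ : ∀ a b c → (a + b ≤ᵇ a + c) ≡ (b ≤ᵇ c)
≤ᵇ-+-cancelˡ a b c =
  T-injective (⇔-trans T-≤ᵇ (⇔-trans (≤-⇔-offset a refl refl) (⇔-sym T-≤ᵇ)))

-- When p m tests m ≤ y, IsFloor p a says a = ⌊y⌋.
IsFloor : (ℕ → Bool) → ℕ → Set
IsFloor p a = ∀ m → T (p (suc m)) ⇔ m < a

Antitone : (ℕ → Bool) → Set
Antitone p = ∀ {m m′} → m ≤ m′ → T (p (suc m′)) → T (p (suc m))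

count-isFloor : IsFloor p a → ∀ k → count p k ≡ k ⊓ a
count-isFloor fl zero = refl
count-isFloor {p} {a} fl (suc k) =
  trans (cong (_+ (if p (suc k) then 1 else 0)) (count-isFloor fl k)) (step (k <? a))
  where
  step : Dec (k < a) → k ⊓ a + (if p (suc k) then 1 else 0) ≡ suc k ⊓ a
  step (yes k<a) rewrite to T-≡ (from (fl k) k<a) | m≤n⇒m⊓n≡m (<⇒≤ k<a) | m≤n⇒m⊓n≡m k<a =
    +-comm k 1
  step (no k≮a) rewrite ¬T⇒≡false (k≮a ∘ to (fl k)) | m≥n⇒m⊓n≡n (≮⇒≥ k≮a)
                      | m≥n⇒m⊓n≡n (m≤n⇒m≤1+n (≮⇒≥ k≮a)) = +-identityʳ a

count≡floor : IsFloor p a → a ≤ k → count p k ≡ a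
count≡floor {k = k} fl a≤k = trans (count-isFloor fl k) (m≥n⇒m⊓n≡n a≤k)

floor-exists : Antitone p → ∀ B → ¬ T (p (suc B)) → Σ[ a ∈ ℕ ] a ≤ B × IsFloor p a
floor-exists anti zero top = 0 , z≤n , λ m → mk⇔ (λ pm → contradiction (anti z≤n pm) top) λ ()
floor-exists {p} anti (suc B) top with T? (p (suc B))
... | no ¬pB = let a , a≤B , fl = floor-exists {p} anti B ¬pB in a , m≤n⇒m≤1+n a≤B , fl
... | yes pB = suc B , ≤-refl , λ m → mk⇔
  (λ pm → decidable-stable (m <? suc B) λ m≮ → top (anti (≮⇒≥ m≮) pm))
  (λ m<sB → anti (≤-pred m<sB) pB)

antitone⇒isFloor-count : Antitone p → ¬ T (p (suc B)) → count p B ≤ B × IsFloor p (count p B)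
antitone⇒isFloor-count {p} {B} anti top with floor-exists {p} anti B top
... | a , a≤B , fl = subst (λ c → c ≤ B × IsFloor p c) (sym (count≡floor fl a≤B)) (a≤B , fl)

count-+ : ∀ p a b → count p (a + b) ≡ count p a + count (λ d → p (a + d)) b
count-+ p a zero rewrite +-identityʳ a = sym (+-identityʳ _)
count-+ p a (suc b) rewrite +-suc a b | count-+ p a b = +-assoc (count p a) (count (λ d → p (a + d)) b) _

count-cong : (∀ m → p m ≡ q m) → ∀ k → count p k ≡ count q k
count-cong eq zero = refl
count-cong eq (suc k) rewrite eq (suc k) | count-cong eq k = refl

count-all : ∀ k → (∀ m → m < k → T (p (suc m))) → count p k ≡ k
count-all zero _ = refl
count-all {p} (suc k) all
  rewrite to T-≡ (all k ≤-refl) | count-all {p} k (λ m m<k → all m (m≤n⇒m≤1+n m<k)) = +-comm k 1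

-- These say m ≤ x φ and m ≤ x γ, as φ and γ are the positive roots of t² = t + 1 and t² + t = 1.
infix 4 _≤_·φ _≤_·γ

_≤_·φ : ℕ → ℕ → Set
m ≤ x ·φ = m * m ≤ m * x + x * x

_≤_·γ : ℕ → ℕ → Set
m ≤ x ·γ = m * m + m * x ≤ x * x

≤⇒≤·φ : m ≤ x → m ≤ x ·φ
≤⇒≤·φ {m} {x} m≤x = ≤-trans (*-monoʳ-≤ m m≤x) (m≤m+n (m * x) (x * x))

≤·γ⇒≤ : m ≤ x ·γ → m ≤ x
≤·γ⇒≤ {m} {x} h = ≮⇒≥ λ x<m → <⇒≱ (*-mono-< x<m x<m) (≤-trans (m≤m+n (m * m) (m * x)) h)

≤·φ-monoʳ : x ≤ c → m ≤ x ·φ → m ≤ c ·φ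
≤·φ-monoʳ {m = m} x≤c h = ≤-trans h (+-mono-≤ (*-monoʳ-≤ m x≤c) (*-mono-≤ x≤c x≤c))

≤·γ-antitoneˡ : c ≤ m → m ≤ x ·γ → c ≤ x ·γ
≤·γ-antitoneˡ {x = x} c≤m h = ≤-trans (+-mono-≤ (*-mono-≤ c≤m c≤m) (*-monoˡ-≤ x c≤m)) h

≤·φ-bound : ∀ x → ¬ suc (2 * x) ≤ x ·φ
≤·φ-bound x = <⇒≱ (begin-strict
  (1 + 2 * x) * x + x * x                          <⟨ s≤s (m≤m+n _ (x * x + 3 * x)) ⟩
  1 + ((1 + 2 * x) * x + x * x + (x * x + 3 * x))  ≡⟨ solve (x ∷ []) ⟩
  (1 + 2 * x) * (1 + 2 * x)                        ∎)
  where open ≤-Reasoning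

+≤·φ⇔≤·γ : ∀ b a → b + a ≤ a ·φ ⇔ b ≤ a ·γ
+≤·φ⇔≤·γ b a = ≤-⇔-offset ((b + a) * a) square refl
  where
  square : (b + a) * (b + a) ≡ (b + a) * a + (b * b + b * a)
  square = solve (a ∷ b ∷ [])

≤·φ⇔≤+·γ : ∀ a b → a ≤ b ·φ ⇔ a ≤ (b + a) ·γ
≤·φ⇔≤+·γ a b = ⇔-sym (≤-⇔-offset (a * a + a * b) lhs rhs)
  where
  lhs : a * a + a * (b + a) ≡ a * a + a * b + a * a
  lhs = solve (a ∷ b ∷ [])
  rhs : (b + a) * (b + a) ≡ a * a + a * b + (a * b + b * b)
  rhs = solve (a ∷ b ∷ [])

-- Below x this is trivial; above x, write c and m as x plus something and use φ = 1 + γ.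
≤·φ-antitoneˡ : c ≤ m → m ≤ x ·φ → c ≤ x ·φ
≤·φ-antitoneˡ {c} {m} {x} c≤m h with c ≤? x
... | yes c≤x = ≤⇒≤·φ c≤x
... | no c≰x = subst (_≤ x ·φ) (m∸n+n≡m x≤c)
  (from (+≤·φ⇔≤·γ (c ∸ x) x) (≤·γ-antitoneˡ (∸-monoˡ-≤ x c≤m)
    (to (+≤·φ⇔≤·γ (m ∸ x) x) (subst (_≤ x ·φ) (sym (m∸n+n≡m (≤-trans x≤c c≤m))) h))))
  where
  x≤c : x ≤ c
  x≤c = <⇒≤ (≰⇒> c≰x)

*-self≡0⇒≡0 : ∀ b → b * b ≡ 0 → b ≡ 0
*-self≡0⇒≡0 zero _ = refl

-- (a, b) ↦ (b, a − b) is the continued-fraction step of φ = 1 + 1/φ.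
golden-descent : a ≡ b + c → a * a ≡ a * b + b * b → b * b ≡ b * c + c * c
golden-descent {b = b} {c} refl e = sym (+-cancelˡ-≡ (b * b + b * c) _ _ (begin
  b * b + b * c + (b * c + c * c) ≡⟨ solve (b ∷ c ∷ []) ⟩
  (b + c) * (b + c)               ≡⟨ e ⟩
  (b + c) * b + b * b             ≡⟨ solve (b ∷ c ∷ []) ⟩
  b * b + b * c + b * b           ∎))
  where open ≡-Reasoning

golden-equation⇒≡0 : ∀ a {b} → a * a ≡ a * b + b * b → b ≡ 0
golden-equation⇒≡0 = <-rec (λ a → ∀ {b} → a * a ≡ a * b + b * b → b ≡ 0) step
  where
  step : ∀ a → (∀ {a′} → a′ < a → ∀ {b} → a′ * a′ ≡ a′ * b + b * b → b ≡ 0) →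
         ∀ {b} → a * a ≡ a * b + b * b → b ≡ 0
  step a rec {b} e with a ≤? b
  ... | yes a≤b = *-self≡0⇒≡0 b (n≤0⇒n≡0 (+-cancelˡ-≤ (a * b) (b * b) 0
        (subst₂ _≤_ e (sym (+-identityʳ (a * b))) (*-monoʳ-≤ a a≤b))))
  ... | no a≰b = *-self≡0⇒≡0 b (begin
        b * b                           ≡⟨ descent ⟩
        b * (a ∸ b) + (a ∸ b) * (a ∸ b) ≡⟨ cong (λ t → b * t + t * t) (rec b<a descent) ⟩
        b * 0 + 0                       ≡⟨ cong (_+ 0) (*-zeroʳ b) ⟩
        0                               ∎)
    where
    open ≡-Reasoning
    b<a : b < a
    b<a = ≰⇒> a≰b
    descent : b * b ≡ b * (a ∸ b) + (a ∸ b) * (a ∸ b)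
    descent = golden-descent (sym (m+[n∸m]≡n (<⇒≤ b<a))) e

φ-irrational : a ≤ b ·φ → b ≤ a ·γ → b ≡ 0
φ-irrational {a} {b} a≤bφ b≤aγ = golden-equation⇒≡0 a (≤-antisym a≤bφ (begin
  a * b + b * b  ≡⟨ +-comm (a * b) (b * b) ⟩
  b * b + a * b  ≡⟨ cong (b * b +_) (*-comm a b) ⟩
  b * b + b * a  ≤⟨ b≤aγ ⟩
  a * a          ∎))
  where open ≤-Reasoning

≰·φ⇒≤·γ : ∀ ℓ k → ℓ ≤ 2 * suc k → ¬ suc ℓ ≤ suc k ·φ → k ≤ ℓ ·γ
≰·φ⇒≤·γ ℓ k ℓ≤2n ℓ+1≰ = decidable-stable (k * k + k * ℓ ≤? ℓ * ℓ) λ k≰ → ℓ+1≰ (begin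
  (1 + ℓ) * (1 + ℓ)                         ≡⟨ solve (ℓ ∷ []) ⟩
  1 + ℓ * ℓ + (ℓ + ℓ)
    ≤⟨ +-mono-≤ (≰⇒> k≰) (+-monoʳ-≤ ℓ (≤-trans ℓ≤2n (m≤m+n _ k))) ⟩
  k * k + k * ℓ + (ℓ + (2 * (1 + k) + k))   ≡⟨ solve (ℓ ∷ k ∷ []) ⟩
  (1 + ℓ) * (1 + k) + (1 + k) * (1 + k)     ∎)
  where open ≤-Reasoning

≤·φ⇔-discriminant : ∀ m x d → 2 * m ≡ x + d → m ≤ x ·φ ⇔ d ^ 2 ≤ 5 * (x * x)
≤·φ⇔-discriminant m x d 2m≡x+d = ⇔-trans ≤-⇔-4* (≤-⇔-offset (x * x + 2 * x * d) lhs rhs)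
  where
  open ≡-Reasoning
  lhs : 4 * (m * m) ≡ x * x + 2 * x * d + d ^ 2
  lhs = begin
    4 * (m * m)                      ≡⟨ solve (m ∷ []) ⟩
    2 * m * (2 * m)                  ≡⟨ cong (λ t → t * t) 2m≡x+d ⟩
    (x + d) * (x + d)                ≡⟨ solve (x ∷ d ∷ []) ⟩
    -- d ^ 2 unfolded: the ring solver does not recognise Data.Nat's _^_
    x * x + 2 * x * d + d * (d * 1)  ∎
  rhs : 4 * (m * x + x * x) ≡ x * x + 2 * x * d + 5 * (x * x)
  rhs = begin
    4 * (m * x + x * x)              ≡⟨ solve (m ∷ x ∷ []) ⟩
    2 * m * (2 * x) + 4 * (x * x)    ≡⟨ cong (λ t → t * (2 * x) + 4 * (x * x)) 2m≡x+d ⟩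
    (x + d) * (2 * x) + 4 * (x * x)  ≡⟨ solve (x ∷ d ∷ []) ⟩
    x * x + 2 * x * d + 5 * (x * x)  ∎

T-leMulφ : ∀ m x → T (leMulφ m x) ⇔ m ≤ x ·φ
T-leMulφ m x with 2 * m ≤ᵇ x in eq
... | true = mk⇔ (λ _ → ≤⇒≤·φ (≤-trans (m≤n*m m 2) (≤ᵇ⇒≤ _ _ (subst T (sym eq) tt)))) (λ _ → tt)
... | false = ⇔-trans T-≤ᵇ (⇔-sym (≤·φ⇔-discriminant m x (2 * m ∸ x) (sym (m+[n∸m]≡n x≤2m))))
  where
  x≤2m : x ≤ 2 * m
  x≤2m = <⇒≤ (≰⇒> (λ 2m≤x → subst T eq (≤⇒≤ᵇ 2m≤x)))

T-leMulγ : ∀ m x → T (leMulγ m x) ⇔ m ≤ x ·γ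
T-leMulγ m x = ⇔-trans T-≤ᵇ (⇔-trans (≤-⇔-offset (x * x) lhs rhs) (⇔-sym ≤-⇔-4*))
  where
  lhs : (2 * m + x) * ((2 * m + x) * 1) ≡ x * x + 4 * (m * m + m * x)
  lhs = solve (m ∷ x ∷ [])
  rhs : 5 * (x * x) ≡ x * x + 4 * (x * x)
  rhs = solve (x ∷ [])

leMulφ²-shift : ∀ x m → leMulφ² (x + m) x ≡ leMulφ m x
leMulφ²-shift x m = begin
  compare (2 * (x + m)) (3 * x)   ≡⟨ cong₂ compare (*-distribˡ-+ 2 x m) 3x≡2x+x ⟩
  compare (2 * x + 2 * m) (2 * x + x)
    ≡⟨ cong₂ _∨_ (≤ᵇ-+-cancelˡ (2 * x) (2 * m) x)
                 (cong (λ t → t ^ 2 ≤ᵇ 5 * (x * x)) ([m+n]∸[m+o]≡n∸o (2 * x) (2 * m) x)) ⟩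
  compare (2 * m) x               ∎
  where
  open ≡-Reasoning
  compare : ℕ → ℕ → Bool
  compare u v = (u ≤ᵇ v) ∨ ((u ∸ v) ^ 2 ≤ᵇ 5 * (x * x))
  3x≡2x+x : 3 * x ≡ 2 * x + x
  3x≡2x+x = solve (x ∷ [])

T-leMulφ²-≤ : m ≤ x → T (leMulφ² m x)
T-leMulφ²-≤ {m} {x} m≤x = from (T-∨ {2 * m ≤ᵇ 3 * x}) (inj₁ (≤⇒≤ᵇ (*-mono-≤ (n≤1+n 2) m≤x)))

U≡+L : ∀ x → U x ≡ x + L x
U≡+L x = begin
  count leφ² (x + 2 * x)                             ≡⟨ count-+ leφ² x (2 * x) ⟩
  count leφ² x + count (λ m → leφ² (x + m)) (2 * x)
    ≡⟨ cong₂ _+_ (count-all x λ _ m<x → T-leMulφ²-≤ m<x) (count-cong (leMulφ²-shift x) (2 * x)) ⟩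
  x + L x                                            ∎
  where
  open ≡-Reasoning
  leφ² : ℕ → Bool
  leφ² m = leMulφ² m x

L-isFloor : ∀ x → L x ≤ 2 * x × IsFloor (λ m → leMulφ m x) (L x)
L-isFloor x = antitone⇒isFloor-count
  (λ {m} {m′} m≤m′ →
    from (T-leMulφ (suc m) x) ∘ ≤·φ-antitoneˡ {x = x} (s≤s m≤m′) ∘ to (T-leMulφ (suc m′) x))
  (≤·φ-bound x ∘ to (T-leMulφ (suc (2 * x)) x))

L≤·φ : ∀ x → L x ≤ x ·φ
L≤·φ x with L x | proj₂ (L-isFloor x)
... | zero  | _  = z≤n
... | suc ℓ | fl = to (T-leMulφ (suc ℓ) x) (from (fl ℓ) ≤-refl)

suc-L≰·φ : ∀ x → ¬ suc (L x) ≤ x ·φ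
suc-L≰·φ x = <-irrefl refl ∘ to (proj₂ (L-isFloor x) (L x)) ∘ from (T-leMulφ (suc (L x)) x)

⌊U·γ⌋≡L : ∀ k → ⌊ U (suc k) ·γ⌋ ≡ L (suc k)
⌊U·γ⌋≡L k rewrite U≡+L (suc k) = count≡floor isFloor (m≤n+m ℓ (suc k))
  where
  ℓ : ℕ
  ℓ = L (suc k)
  ℓ≤U·γ : ℓ ≤ (suc k + ℓ) ·γ
  ℓ≤U·γ = to (≤·φ⇔≤+·γ ℓ (suc k)) (L≤·φ (suc k))
  ℓ+1≰U·γ : ¬ suc ℓ ≤ (suc k + ℓ) ·γ
  ℓ+1≰U·γ h = suc-L≰·φ (suc k) (≤·φ-monoʳ {m = suc ℓ} (n≤1+n k)
    (from (≤·φ⇔≤+·γ (suc ℓ) k) (subst (λ y → suc ℓ ≤ y ·γ) (sym (+-suc k ℓ)) h)))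
  isFloor : IsFloor (λ m → leMulγ m (suc k + ℓ)) ℓ
  isFloor m = ⇔-trans (T-leMulγ (suc m) (suc k + ℓ)) (mk⇔
    (λ h → decidable-stable (m <? ℓ) λ m≮ℓ → ℓ+1≰U·γ (≤·γ-antitoneˡ {x = suc k + ℓ} (s≤s (≮⇒≥ m≮ℓ)) h))
    (λ m<ℓ → ≤·γ-antitoneˡ {x = suc k + ℓ} m<ℓ ℓ≤U·γ))

⌊L·φ⌋≡pred+L : ∀ k → ⌊ L (suc k) ·φ⌋ ≡ k + L (suc k)
⌊L·φ⌋≡pred+L k = count≡floor isFloor k+ℓ≤2ℓ
  where
  ℓ : ℕ
  ℓ = L (suc k)
  k≤ℓγ : k ≤ ℓ ·γ
  k≤ℓγ = ≰·φ⇒≤·γ ℓ k (proj₁ (L-isFloor (suc k))) (suc-L≰·φ (suc k))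
  k+ℓ≤2ℓ : k + ℓ ≤ 2 * ℓ
  k+ℓ≤2ℓ = subst (k + ℓ ≤_) (cong (ℓ +_) (sym (+-identityʳ ℓ)))
    (+-monoˡ-≤ ℓ (≤·γ⇒≤ {k} {ℓ} k≤ℓγ))
  k+ℓ≤ℓφ : k + ℓ ≤ ℓ ·φ
  k+ℓ≤ℓφ = from (+≤·φ⇔≤·γ k ℓ) k≤ℓγ
  n+ℓ≰ℓφ : ¬ (suc k + ℓ) ≤ ℓ ·φ
  n+ℓ≰ℓφ h = 1+n≢0 (φ-irrational {ℓ} {suc k} (L≤·φ (suc k)) (to (+≤·φ⇔≤·γ (suc k) ℓ) h))
  isFloor : IsFloor (λ m → leMulφ m ℓ) (k + ℓ)
  isFloor m = ⇔-trans (T-leMulφ (suc m) ℓ) (mk⇔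
    (λ h → decidable-stable (m <? k + ℓ) λ m≮ → n+ℓ≰ℓφ (≤·φ-antitoneˡ {x = ℓ} (s≤s (≮⇒≥ m≮)) h))
    (λ m<k+ℓ → ≤·φ-antitoneˡ {x = ℓ} m<k+ℓ k+ℓ≤ℓφ))

proposition4 : (W : ℕ → ℕ) → W 0 ≡ 0
    → (∀ n → 1 ≤ n → W (L n) ≡ U n)
    → (∀ n → 1 ≤ n → W (U n) ≡ L n)
    → ∀ n → 1 ≤ n → (W (U n) ≡ ⌊ U n ·γ⌋) × (W (L n) ≡ ⌊ L n ·φ⌋ + 1)
proposition4 W _ W∘L W∘U (suc k) 1≤n =
  trans (W∘U n 1≤n) (sym (⌊U·γ⌋≡L k)) ,
  (begin
    W (L n)            ≡⟨ W∘L n 1≤n ⟩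
    U n                ≡⟨ U≡+L n ⟩
    suc (k + L n)      ≡⟨ +-comm 1 (k + L n) ⟩
    k + L n + 1        ≡⟨ cong (_+ 1) (sym (⌊L·φ⌋≡pred+L k)) ⟩
    ⌊ L n ·φ⌋ + 1      ∎)
  where
  open ≡-Reasoning
  n : ℕ
  n = suc k
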